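{- Let $n\ge 1$ and let $L$ be the boolean lattice of subsets of $[n]=\{1,\dots,n\}$ ordered by inclusion. Then there are at least $2^{a_n}$ transfer systems on $L$, where $a_n=\sum_{j=0}^{(n-1)/2}\binom{n}{j}\binom{n-j}{n-2j}$ if $n$ is odd, and $a_n=\sum_{j=1}^{n/2}\binom{n}{j}\binom{n-j}{n+1-2j}$ if $n$ is even.
   Context: A transfer system on a lattice $(L,\le)$ is a partial order $\lhd$ on $L$ such that $i\lhd j$ implies $i\le j$, and $i\lhd k$, $j\le k$ imply $(i\wedge j)\lhd j$. -}

module Defs where

open import Data.Bool using (Bool; T)
open import Data.Nat using (ℕ; zero; suc; _+_; _*_; _∸_; _^_; _/_; _%_)
open import Data.Nat.Combinatorics using (_C_)
open import Data.List using (map; upTo)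
open import Data.Nat.ListAction using (sum)
open import Data.Fin using (Fin)
open import Data.Fin.Subset using (Subset; _⊆_; _∩_)
open import Relation.Binary.PropositionalEquality using (_≡_)

-- Boolean lattice of subsets of [n] (represented as Fin n), ordered by ⊆, meet ∩.
-- A (decidable, hence Bool-valued) binary relation on it:
Rel₂ : ℕ → Set
Rel₂ n = Subset n → Subset n → Bool

record IsTransferSystem {n : ℕ} (R : Rel₂ n) : Set where
  field
    reflexive  : ∀ x → T (R x x)
    antisym    : ∀ x y → T (R x y) → T (R y x) → x ≡ y
    transitive : ∀ x y z → T (R x y) → T (R y z) → T (R x z)
    refines    : ∀ i j → T (R i j) → i ⊆ j
    restrict   : ∀ i j k → T (R i k) → j ⊆ k → T (R (i ∩ j) j)

-- inclusive sum  Σ_{j=lo}^{hi} f j  (empty if hi < lo)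
sumRange : ℕ → ℕ → (ℕ → ℕ) → ℕ
sumRange lo hi f = sum (map (λ i → f (lo + i)) (upTo (suc hi ∸ lo)))

a : ℕ → ℕ
a n with n % 2
... | zero  = sumRange 1 (n / 2) (λ j → (n C j) * ((n ∸ j) C (n + 1 ∸ 2 * j)))
... | suc _ = sumRange 0 ((n ∸ 1) / 2) (λ j → (n C j) * ((n ∸ j) C (n ∸ 2 * j)))

-- Fix a level N and call |x| + |y| the weight of a pair x ⊆ y. Let x ◁ y hold iff x = y, or
-- x ⊆ y has weight < N, or (x, y) lies in an arbitrary set S of pairs x ⊆ y of weight N.
-- This is a transfer system for every S: composing two arrows x ⊂ y ⊆ z, or restricting an
-- arrow i ⊆ k along a proper inclusion j ⊂ k, yields a pair of strictly smaller weight than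
-- an arrow already present, hence of weight < N. On the proper pairs of weight N the relation
-- ◁ is exactly S, so these pairs can be added independently. The proper pairs of weight N
-- with |x| = j number C(n,j)·C(n−j,N−2j) (choose x, then y ∖ x); with N = n for odd n and
-- N = n + 1 for even n, the number of all of them is a_n.
module Submission where

open import Defs
open import Data.Bool using (Bool; T; T?)
import Data.Bool as Bool
open import Data.Nat
  using (ℕ; zero; suc; _+_; _*_; _∸_; _^_; _/_; _%_; _≤_; _<_; _≟_; _<?_; s≤s; z<s)
open import Data.Nat.Properties
  using ( ≤-reflexive; <⇒≤; <⇒≢; ≤-<-trans; <-≤-trans; ≮⇒≥; +-monoˡ-<; +-mono-≤-<; *-monoʳ-≤
        ; +-suc; +-assoc; +-comm; +-identityʳ; *-identityˡ; *-identityʳ; *-comm; *-distribʳ-+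
        ; +-cancelˡ-≡; +-∸-assoc; m+[n∸m]≡n; m<m+n; m<n⇒0<n∸m; 0∸n≡0)
open import Data.Nat.DivMod using (m/n*n≤m)
open import Data.Nat.Combinatorics using (_C_; nCk+nC[k+1]≡[n+1]C[k+1]; k>n⇒nCk≡0)
open import Data.Nat.ListAction using (sum)
open import Data.Nat.Tactic.RingSolver using (solve-∀)
open import Data.Fin using (Fin; zero; suc; combine; finToFun; funToFin)
import Data.Fin.Properties as Finₚ
open import Data.Fin.Subset using (Subset; Side; _⊆_; _∩_; ∣_∣; inside; outside)
open import Data.Fin.Subset.Properties
  using ( _⊆?_; ⊆-refl; ⊆-trans; ⊆-antisym; drop-∷-⊆; s⊆s; out⊆; in⊆in; p⊆q⇒∣p∣≤∣q∣
        ; p∩q⊆p; p∩q⊆q; x∈p∩q⁺; ∣p∩q∣≤∣p∣)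
open import Data.Vec using ([]; _∷_; here)
import Data.Vec.Properties as Vec
open import Data.Product using (Σ; _×_; _,_; proj₁; proj₂)
import Data.Product.Properties as Product
open import Data.Sum using (_⊎_; inj₁; inj₂; [_,_])
open import Data.List using (List; []; _∷_; _++_; map; concat; upTo; length; lookup)
open import Data.List.Properties using (length-++; length-map; map-∘; map-cong)
open import Data.List.Membership.Propositional.Properties using (∈-map⁻; ∈-++⁻; ∈-lookup)
open import Data.List.Relation.Unary.All using (All; []; _∷_)
import Data.List.Relation.Unary.All as All
import Data.List.Relation.Unary.All.Properties as All
open import Data.List.Relation.Unary.AllPairs using ([]; _∷_)
import Data.List.Relation.Unary.AllPairs as AllPairs
import Data.List.Relation.Unary.AllPairs.Properties as AllPairs
open import Data.List.Relation.Unary.Unique.Propositional using (Unique)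
import Data.List.Relation.Unary.Unique.Propositional.Properties as Unique
open import Data.List.Relation.Binary.Disjoint.Propositional using (Disjoint)
open import Function.Base using (id; _∘_)
open import Function.Bundles using (mk⇔)
open import Relation.Binary.Definitions using (Decidable; DecidableEquality)
open import Relation.Nullary using (Dec; yes; no; does; contradiction)
open import Relation.Nullary.Decidable
  using (isYes; toWitness; fromWitness; isYes≗does; does-⇔; _⊎-dec_; _×-dec_)
open import Relation.Binary.PropositionalEquality
  using (_≡_; _≢_; _≗_; refl; sym; trans; cong; cong₂; subst)
open Relation.Binary.PropositionalEquality.≡-Reasoning

_≟ˢ_ : ∀ {n} → DecidableEquality (Subset n)
_≟ˢ_ = Vec.≡-dec Bool._≟_

p⊆q∧p≢q⇒∣p∣<∣q∣ : ∀ {n} {p q : Subset n} → p ⊆ q → p ≢ q → ∣ p ∣ < ∣ q ∣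
p⊆q∧p≢q⇒∣p∣<∣q∣ {p = []}          {[]}          _   p≢q = contradiction refl p≢q
p⊆q∧p≢q⇒∣p∣<∣q∣ {p = outside ∷ p} {outside ∷ q} p⊆q p≢q =
  p⊆q∧p≢q⇒∣p∣<∣q∣ (drop-∷-⊆ p⊆q) (p≢q ∘ cong (outside ∷_))
p⊆q∧p≢q⇒∣p∣<∣q∣ {p = outside ∷ p} {inside  ∷ q} p⊆q _   = s≤s (p⊆q⇒∣p∣≤∣q∣ (drop-∷-⊆ p⊆q))
p⊆q∧p≢q⇒∣p∣<∣q∣ {p = inside  ∷ p} {outside ∷ q} p⊆q _   with () ← p⊆q here
p⊆q∧p≢q⇒∣p∣<∣q∣ {p = inside  ∷ p} {inside  ∷ q} p⊆q p≢q =
  s≤s (p⊆q∧p≢q⇒∣p∣<∣q∣ (drop-∷-⊆ p⊆q) (p≢q ∘ cong (inside ∷_)))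

p⊆q⇒p∩q≡p : ∀ {n} {p q : Subset n} → p ⊆ q → p ∩ q ≡ p
p⊆q⇒p∩q≡p {p = p} {q} p⊆q = ⊆-antisym (p∩q⊆p p q) (λ x∈p → x∈p∩q⁺ (x∈p , p⊆q x∈p))

q⊆p⇒p∩q≡q : ∀ {n} {p q : Subset n} → q ⊆ p → p ∩ q ≡ q
q⊆p⇒p∩q≡q {p = p} {q} q⊆p = ⊆-antisym (p∩q⊆q p q) (λ x∈q → x∈p∩q⁺ (q⊆p x∈q , x∈q))

module Layer {n : ℕ} (N : ℕ) (S : Subset n → Subset n → Bool) where

  Allowed : Subset n → Subset n → Set
  Allowed x y = ∣ x ∣ + ∣ y ∣ < N ⊎ (∣ x ∣ + ∣ y ∣ ≡ N × T (S x y))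

  infix 4 _◁_ _◁ᵇ_

  _◁_ : Subset n → Subset n → Set
  x ◁ y = x ≡ y ⊎ (x ⊆ y × Allowed x y)

  _◁?_ : Decidable _◁_
  x ◁? y = (x ≟ˢ y) ⊎-dec ((x ⊆? y) ×-dec
    ((∣ x ∣ + ∣ y ∣ <? N) ⊎-dec ((∣ x ∣ + ∣ y ∣ ≟ N) ×-dec T? (S x y))))

  _◁ᵇ_ : Rel₂ n
  x ◁ᵇ y = isYes (x ◁? y)

  Allowed⇒≤ : ∀ {x y} → Allowed x y → ∣ x ∣ + ∣ y ∣ ≤ N
  Allowed⇒≤ (inj₁ w<N)       = <⇒≤ w<N
  Allowed⇒≤ (inj₂ (w≡N , _)) = ≤-reflexive w≡N

  ◁⇒⊆ : ∀ {x y} → x ◁ y → x ⊆ y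
  ◁⇒⊆ (inj₁ refl)      = ⊆-refl
  ◁⇒⊆ (inj₂ (x⊆y , _)) = x⊆y

  ◁-trans : ∀ {x y z} → x ◁ y → y ◁ z → x ◁ z
  ◁-trans (inj₁ refl) y◁z = y◁z
  ◁-trans x◁y (inj₁ refl) = x◁y
  ◁-trans {x} {y} {z} (inj₂ (x⊆y , _)) (inj₂ (y⊆z , allowed)) with x ≟ˢ y
  ... | yes refl = inj₂ (y⊆z , allowed)
  ... | no x≢y   = inj₂ (⊆-trans x⊆y y⊆z , inj₁ (<-≤-trans
    (+-monoˡ-< ∣ z ∣ (p⊆q∧p≢q⇒∣p∣<∣q∣ x⊆y x≢y)) (Allowed⇒≤ allowed)))

  ◁-restrict : ∀ {i j k} → i ◁ k → j ⊆ k → i ∩ j ◁ j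
  ◁-restrict (inj₁ refl) j⊆i = inj₁ (q⊆p⇒p∩q≡q j⊆i)
  ◁-restrict {i} {j} {k} (inj₂ (i⊆k , allowed)) j⊆k with j ≟ˢ k
  ... | yes refl rewrite p⊆q⇒p∩q≡p i⊆k = inj₂ (i⊆k , allowed)
  ... | no j≢k   = inj₂ (p∩q⊆q i j , inj₁ (<-≤-trans
    (+-mono-≤-< (∣p∩q∣≤∣p∣ i j) (p⊆q∧p≢q⇒∣p∣<∣q∣ j⊆k j≢k)) (Allowed⇒≤ allowed)))

  isTransferSystem : IsTransferSystem _◁ᵇ_
  isTransferSystem = record
    { reflexive  = λ _ → fromWitness (inj₁ refl)
    ; antisym    = λ _ _ x◁y y◁x → ⊆-antisym (◁⇒⊆ (toWitness x◁y)) (◁⇒⊆ (toWitness y◁x))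
    ; transitive = λ _ _ _ x◁y y◁z → fromWitness (◁-trans (toWitness x◁y) (toWitness y◁z))
    ; refines    = λ _ _ i◁j → ◁⇒⊆ (toWitness i◁j)
    ; restrict   = λ _ _ _ i◁k j⊆k → fromWitness (◁-restrict (toWitness i◁k) j⊆k)
    }

  ◁ᵇ-onLevel : ∀ {x y} → x ⊆ y → ∣ x ∣ < ∣ y ∣ → ∣ x ∣ + ∣ y ∣ ≡ N → (x ◁ᵇ y) ≡ S x y
  ◁ᵇ-onLevel {x} {y} x⊆y ∣x∣<∣y∣ w≡N = trans (isYes≗does (x ◁? y))
    (does-⇔ (mk⇔ selected (λ Sxy → inj₂ (x⊆y , inj₂ (w≡N , Sxy)))) (x ◁? y) (T? (S x y)))
    where
    selected : x ◁ y → T (S x y)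
    selected (inj₁ refl)                 = contradiction refl (<⇒≢ ∣x∣<∣y∣)
    selected (inj₂ (_ , inj₁ w<N))       = contradiction w≡N (<⇒≢ w<N)
    selected (inj₂ (_ , inj₂ (_ , Sxy))) = Sxy

multinomial : ℕ → ℕ → ℕ → ℕ
multinomial n i d = (n C i) * ((n ∸ i) C d)

pascal : ∀ n k → suc n C suc k ≡ n C k + n C suc k
pascal n k = sym (nCk+nC[k+1]≡[n+1]C[k+1] n k)

multinomial-pascal-zero-suc : ∀ n d →
  multinomial (suc n) 0 (suc d) ≡ multinomial n 0 (suc d) + multinomial n 0 d
multinomial-pascal-zero-suc n d = begin
  1 * (suc n C suc d)            ≡⟨ *-identityˡ (suc n C suc d) ⟩
  suc n C suc d                  ≡⟨ pascal n d ⟩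
  n C d + n C suc d              ≡⟨ +-comm (n C d) (n C suc d) ⟩
  n C suc d + n C d              ≡⟨ cong₂ _+_ (*-identityˡ (n C suc d)) (*-identityˡ (n C d)) ⟨
  1 * (n C suc d) + 1 * (n C d)  ∎

multinomial-pascal-suc-zero : ∀ n i →
  multinomial (suc n) (suc i) 0 ≡ multinomial n (suc i) 0 + multinomial n i 0
multinomial-pascal-suc-zero n i = begin
  (suc n C suc i) * 1            ≡⟨ *-identityʳ (suc n C suc i) ⟩
  suc n C suc i                  ≡⟨ pascal n i ⟩
  n C i + n C suc i              ≡⟨ +-comm (n C i) (n C suc i) ⟩
  n C suc i + n C i              ≡⟨ cong₂ _+_ (*-identityʳ (n C suc i)) (*-identityʳ (n C i)) ⟨
  (n C suc i) * 1 + (n C i) * 1  ∎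

multinomial-pascal-suc-suc : ∀ n i d → multinomial (suc n) (suc i) (suc d) ≡
  multinomial n (suc i) (suc d) + (multinomial n (suc i) d + multinomial n i (suc d))
multinomial-pascal-suc-suc n i d = begin
  (suc n C suc i) * ((n ∸ i) C suc d)
    ≡⟨ cong (_* ((n ∸ i) C suc d)) (pascal n i) ⟩
  (n C i + n C suc i) * ((n ∸ i) C suc d)
    ≡⟨ *-distribʳ-+ ((n ∸ i) C suc d) (n C i) (n C suc i) ⟩
  (n C i) * ((n ∸ i) C suc d) + (n C suc i) * ((n ∸ i) C suc d)
    ≡⟨ cong ((n C i) * ((n ∸ i) C suc d) +_) (pascal-on-complement (i <? n)) ⟩
  (n C i) * ((n ∸ i) C suc d) + (n C suc i) * ((n ∸ suc i) C d + (n ∸ suc i) C suc d)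
    ≡⟨ regroup (n C i) ((n ∸ i) C suc d) (n C suc i) ((n ∸ suc i) C d) ((n ∸ suc i) C suc d) ⟩
  (n C suc i) * ((n ∸ suc i) C suc d) + ((n C suc i) * ((n ∸ suc i) C d) + (n C i) * ((n ∸ i) C suc d))
    ∎
  where
  pascal-on-complement : Dec (i < n) →
    (n C suc i) * ((n ∸ i) C suc d) ≡ (n C suc i) * ((n ∸ suc i) C d + (n ∸ suc i) C suc d)
  pascal-on-complement (yes i<n) = cong ((n C suc i) *_)
    (trans (cong (_C suc d) (+-∸-assoc 1 i<n)) (pascal (n ∸ suc i) d))
  pascal-on-complement (no i≮n) rewrite k>n⇒nCk≡0 (s≤s (≮⇒≥ i≮n)) = refl
  regroup : ∀ a b c p q → a * b + c * (p + q) ≡ c * q + (c * p + a * b)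
  regroup = solve-∀

Pair : ℕ → Set
Pair n = Subset n × Subset n

extend : ∀ {n} → Side → Side → Pair n → Pair (suc n)
extend a b (x , y) = a ∷ x , b ∷ y

-- The pairs x ⊆ y with ∣ x ∣ = i and ∣ y ∣ = i + d, split by where element 0 lies.
nestedPairs : ∀ n → ℕ → ℕ → List (Pair n)
nestedPairs zero    zero    zero    = ([] , []) ∷ []
nestedPairs zero    zero    (suc d) = []
nestedPairs zero    (suc i) d       = []
nestedPairs (suc n) zero    zero    = map (extend outside outside) (nestedPairs n zero zero)
nestedPairs (suc n) zero    (suc d) = map (extend outside outside) (nestedPairs n zero (suc d))
                                   ++ map (extend outside inside) (nestedPairs n zero d)
nestedPairs (suc n) (suc i) zero    = map (extend outside outside) (nestedPairs n (suc i) zero)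
                                   ++ map (extend inside inside) (nestedPairs n i zero)
nestedPairs (suc n) (suc i) (suc d) = map (extend outside outside) (nestedPairs n (suc i) (suc d))
                                   ++ map (extend outside inside) (nestedPairs n (suc i) d)
                                   ++ map (extend inside inside) (nestedPairs n i (suc d))

module _ {a b} {A : Set a} {B : Set b} where

  length-map₂ : ∀ (f g : A → B) xs ys → length (map f xs ++ map g ys) ≡ length xs + length ys
  length-map₂ f g xs ys =
    trans (length-++ (map f xs)) (cong₂ _+_ (length-map f xs) (length-map g ys))

  length-map₃ : ∀ (f g h : A → B) xs ys zs →
    length (map f xs ++ map g ys ++ map h zs) ≡ length xs + (length ys + length zs)
  length-map₃ f g h xs ys zs =
    trans (length-++ (map f xs)) (cong₂ _+_ (length-map f xs) (length-map₂ g h ys zs))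

length-nestedPairs : ∀ n i d → length (nestedPairs n i d) ≡ multinomial n i d
length-nestedPairs zero    zero    zero    = refl
length-nestedPairs zero    zero    (suc d) = refl
length-nestedPairs zero    (suc i) d       = refl
length-nestedPairs (suc n) zero    zero    =
  trans (length-map _ (nestedPairs n 0 0)) (length-nestedPairs n 0 0)
length-nestedPairs (suc n) zero    (suc d) = begin
  length (nestedPairs (suc n) 0 (suc d))
    ≡⟨ length-map₂ _ _ (nestedPairs n 0 (suc d)) (nestedPairs n 0 d) ⟩
  length (nestedPairs n 0 (suc d)) + length (nestedPairs n 0 d)
    ≡⟨ cong₂ _+_ (length-nestedPairs n 0 (suc d)) (length-nestedPairs n 0 d) ⟩
  multinomial n 0 (suc d) + multinomial n 0 d
    ≡⟨ multinomial-pascal-zero-suc n d ⟨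
  multinomial (suc n) 0 (suc d) ∎
length-nestedPairs (suc n) (suc i) zero    = begin
  length (nestedPairs (suc n) (suc i) 0)
    ≡⟨ length-map₂ _ _ (nestedPairs n (suc i) 0) (nestedPairs n i 0) ⟩
  length (nestedPairs n (suc i) 0) + length (nestedPairs n i 0)
    ≡⟨ cong₂ _+_ (length-nestedPairs n (suc i) 0) (length-nestedPairs n i 0) ⟩
  multinomial n (suc i) 0 + multinomial n i 0
    ≡⟨ multinomial-pascal-suc-zero n i ⟨
  multinomial (suc n) (suc i) 0 ∎
length-nestedPairs (suc n) (suc i) (suc d) = begin
  length (nestedPairs (suc n) (suc i) (suc d))
    ≡⟨ length-map₃ _ _ _ A B C ⟩
  length A + (length B + length C)
    ≡⟨ cong₂ _+_ (length-nestedPairs n (suc i) (suc d))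
                 (cong₂ _+_ (length-nestedPairs n (suc i) d) (length-nestedPairs n i (suc d))) ⟩
  multinomial n (suc i) (suc d) + (multinomial n (suc i) d + multinomial n i (suc d))
    ≡⟨ multinomial-pascal-suc-suc n i d ⟨
  multinomial (suc n) (suc i) (suc d) ∎
  where
  A = nestedPairs n (suc i) (suc d)
  B = nestedPairs n (suc i) d
  C = nestedPairs n i (suc d)

Shape : ∀ {n} → ℕ → ℕ → Pair n → Set
Shape i d (x , y) = x ⊆ y × ∣ x ∣ ≡ i × ∣ y ∣ ≡ i + d

module _ {n i d : ℕ} {p : Pair n} where

  Shape-extend-outside : Shape i d p → Shape i d (extend outside outside p)
  Shape-extend-outside (x⊆y , ∣x∣≡i , ∣y∣≡i+d) = s⊆s x⊆y , ∣x∣≡i , ∣y∣≡i+d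

  Shape-extend-right : Shape i d p → Shape i (suc d) (extend outside inside p)
  Shape-extend-right (x⊆y , ∣x∣≡i , ∣y∣≡i+d) =
    out⊆ x⊆y , ∣x∣≡i , trans (cong suc ∣y∣≡i+d) (sym (+-suc i d))

  Shape-extend-inside : Shape i d p → Shape (suc i) d (extend inside inside p)
  Shape-extend-inside (x⊆y , ∣x∣≡i , ∣y∣≡i+d) = in⊆in x⊆y , cong suc ∣x∣≡i , cong suc ∣y∣≡i+d

nestedPairs-shape : ∀ n i d → All (Shape i d) (nestedPairs n i d)
nestedPairs-shape zero    zero    zero    = (⊆-refl , refl , refl) ∷ []
nestedPairs-shape zero    zero    (suc d) = []
nestedPairs-shape zero    (suc i) d       = []
nestedPairs-shape (suc n) zero    zero    =
  All.map⁺ (All.map Shape-extend-outside (nestedPairs-shape n 0 0))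
nestedPairs-shape (suc n) zero    (suc d) = All.++⁺
  (All.map⁺ (All.map Shape-extend-outside (nestedPairs-shape n 0 (suc d))))
  (All.map⁺ (All.map Shape-extend-right (nestedPairs-shape n 0 d)))
nestedPairs-shape (suc n) (suc i) zero    = All.++⁺
  (All.map⁺ (All.map Shape-extend-outside (nestedPairs-shape n (suc i) 0)))
  (All.map⁺ (All.map Shape-extend-inside (nestedPairs-shape n i 0)))
nestedPairs-shape (suc n) (suc i) (suc d) = All.++⁺
  (All.map⁺ (All.map Shape-extend-outside (nestedPairs-shape n (suc i) (suc d))))
  (All.++⁺ (All.map⁺ (All.map Shape-extend-right (nestedPairs-shape n (suc i) d)))
           (All.map⁺ (All.map Shape-extend-inside (nestedPairs-shape n i (suc d)))))

extend-injective : ∀ {n a b} {p q : Pair n} → extend a b p ≡ extend a b q → p ≡ q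
extend-injective {p = _ , _} {_ , _} refl = refl

map-extend-disjoint : ∀ {n a b a′ b′} {ps qs : List (Pair n)} → (a , b) ≢ (a′ , b′) →
  Disjoint (map (extend a b) ps) (map (extend a′ b′) qs)
map-extend-disjoint ab≢a′b′ (v∈ps , v∈qs) with ∈-map⁻ _ v∈ps | ∈-map⁻ _ v∈qs
... | (_ , _) , _ , refl | (_ , _) , _ , refl = ab≢a′b′ refl

module _ {a} {A : Set a} where

  Disjoint-++ : ∀ {xs} ys {zs : List A} → Disjoint xs ys → Disjoint xs zs → Disjoint xs (ys ++ zs)
  Disjoint-++ ys xs#ys xs#zs (v∈xs , v∈ys++zs) =
    [ (λ v∈ys → xs#ys (v∈xs , v∈ys)) , (λ v∈zs → xs#zs (v∈xs , v∈zs)) ] (∈-++⁻ ys v∈ys++zs)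

nestedPairs-unique : ∀ n i d → Unique (nestedPairs n i d)
nestedPairs-unique zero    zero    zero    = [] ∷ []
nestedPairs-unique zero    zero    (suc d) = []
nestedPairs-unique zero    (suc i) d       = []
nestedPairs-unique (suc n) zero    zero    = Unique.map⁺ extend-injective (nestedPairs-unique n 0 0)
nestedPairs-unique (suc n) zero    (suc d) = Unique.++⁺
  (Unique.map⁺ extend-injective (nestedPairs-unique n 0 (suc d)))
  (Unique.map⁺ extend-injective (nestedPairs-unique n 0 d))
  (map-extend-disjoint λ ())
nestedPairs-unique (suc n) (suc i) zero    = Unique.++⁺
  (Unique.map⁺ extend-injective (nestedPairs-unique n (suc i) 0))
  (Unique.map⁺ extend-injective (nestedPairs-unique n i 0))
  (map-extend-disjoint λ ())
nestedPairs-unique (suc n) (suc i) (suc d) = Unique.++⁺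
  (Unique.map⁺ extend-injective (nestedPairs-unique n (suc i) (suc d)))
  (Unique.++⁺ (Unique.map⁺ extend-injective (nestedPairs-unique n (suc i) d))
              (Unique.map⁺ extend-injective (nestedPairs-unique n i (suc d)))
              (map-extend-disjoint λ ()))
  (Disjoint-++ (map (extend outside inside) (nestedPairs n (suc i) d))
               (map-extend-disjoint λ ()) (map-extend-disjoint λ ()))

Critical : ∀ {n} → ℕ → Pair n → Set
Critical N (x , y) = x ⊆ y × ∣ x ∣ < ∣ y ∣ × ∣ x ∣ + ∣ y ∣ ≡ N

Shape⇒Critical : ∀ {n N j} {p : Pair n} → 2 * j < N → Shape j (N ∸ 2 * j) p → Critical N p
Shape⇒Critical {N = N} {j} 2j<N (x⊆y , ∣x∣≡j , ∣y∣≡j+[N∸2j]) rewrite ∣x∣≡j | ∣y∣≡j+[N∸2j] =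
  x⊆y , m<m+n j (m<n⇒0<n∸m 2j<N) , (begin
    j + (j + (N ∸ 2 * j))  ≡⟨ +-assoc j j _ ⟨
    j + j + (N ∸ 2 * j)    ≡⟨ cong (λ k → j + k + (N ∸ 2 * j)) (+-identityʳ j) ⟨
    2 * j + (N ∸ 2 * j)    ≡⟨ m+[n∸m]≡n (<⇒≤ 2j<N) ⟩
    N                      ∎)

levelPairs : ∀ n → ℕ → ℕ → List (Pair n)
levelPairs n N j = nestedPairs n j (N ∸ 2 * j)

levelPairs-disjoint : ∀ n N {j j′} → j ≢ j′ → Disjoint (levelPairs n N j) (levelPairs n N j′)
levelPairs-disjoint n N {j} {j′} j≢j′ (p∈ , p∈′)
  with _ , ∣x∣≡j  , _ ← All.lookup (nestedPairs-shape n j _) p∈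
     | _ , ∣x∣≡j′ , _ ← All.lookup (nestedPairs-shape n j′ _) p∈′
  = j≢j′ (trans (sym ∣x∣≡j) ∣x∣≡j′)

criticalPairs : ∀ n (N lo hi : ℕ) → List (Pair n)
criticalPairs n N lo hi = concat (map (λ i → levelPairs n N (lo + i)) (upTo (suc hi ∸ lo)))

module _ {a} {A : Set a} where

  length-concat : (xss : List (List A)) → length (concat xss) ≡ sum (map length xss)
  length-concat []         = refl
  length-concat (xs ∷ xss) = trans (length-++ xs) (cong (length xs +_) (length-concat xss))

length-criticalPairs : ∀ n N lo hi →
  length (criticalPairs n N lo hi) ≡ sumRange lo hi (λ j → multinomial n j (N ∸ 2 * j))
length-criticalPairs n N lo hi = begin
  length (concat (map block is))   ≡⟨ length-concat (map block is) ⟩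
  sum (map length (map block is))  ≡⟨ cong sum (map-∘ is) ⟨
  sum (map (length ∘ block) is)    ≡⟨ cong sum (map-cong (λ i → length-nestedPairs n (lo + i) _) is) ⟩
  sumRange lo hi (λ j → multinomial n j (N ∸ 2 * j)) ∎
  where
  is = upTo (suc hi ∸ lo)
  block = λ i → levelPairs n N (lo + i)

criticalPairs-unique : ∀ n N lo hi → Unique (criticalPairs n N lo hi)
criticalPairs-unique n N lo hi = Unique.concat⁺
  (All.map⁺ (All.applyUpTo⁺₂ id _ λ i → nestedPairs-unique n (lo + i) _))
  (AllPairs.map⁺ (AllPairs.map blocks-disjoint (Unique.upTo⁺ (suc hi ∸ lo))))
  where
  blocks-disjoint : ∀ {i i′} → i ≢ i′ → Disjoint (levelPairs n N (lo + i)) (levelPairs n N (lo + i′))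
  blocks-disjoint i≢i′ = levelPairs-disjoint n N (i≢i′ ∘ +-cancelˡ-≡ lo _ _)

i<1+n∸m⇒m+i≤n : ∀ m {n i} → i < suc n ∸ m → m + i ≤ n
i<1+n∸m⇒m+i≤n zero            (s≤s i≤n) = i≤n
i<1+n∸m⇒m+i≤n (suc m) {zero} {i} i<0   = contradiction (subst (i <_) (0∸n≡0 m) i<0) λ ()
i<1+n∸m⇒m+i≤n (suc m) {suc n}    i<n∸m = s≤s (i<1+n∸m⇒m+i≤n m i<n∸m)

criticalPairs-critical : ∀ n N lo hi → 2 * hi < N → All (Critical N) (criticalPairs n N lo hi)
criticalPairs-critical n N lo hi 2hi<N =
  All.concat⁺ (All.map⁺ (All.applyUpTo⁺₁ id (suc hi ∸ lo) block-critical))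
  where
  block-critical : ∀ {i} → i < suc hi ∸ lo → All (Critical N) (levelPairs n N (lo + i))
  block-critical {i} i<k = All.map
    (Shape⇒Critical (≤-<-trans (*-monoʳ-≤ 2 (i<1+n∸m⇒m+i≤n lo i<k)) 2hi<N))
    (nestedPairs-shape n (lo + i) _)

module _ {a} {A : Set a} where

  Unique⇒lookup-injective : ∀ {xs : List A} → Unique xs →
    ∀ {i j} → lookup xs i ≡ lookup xs j → i ≡ j
  Unique⇒lookup-injective (_  ∷ _) {zero}  {zero}  _ = refl
  Unique⇒lookup-injective (x∉ ∷ _) {zero}  {suc j} x≡xⱼ =
    contradiction x≡xⱼ (All.lookup x∉ (∈-lookup j))
  Unique⇒lookup-injective (x∉ ∷ _) {suc i} {zero}  xᵢ≡x =
    contradiction (sym xᵢ≡x) (All.lookup x∉ (∈-lookup i))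
  Unique⇒lookup-injective (_  ∷ u) {suc i} {suc j} xᵢ≡xⱼ =
    cong suc (Unique⇒lookup-injective u xᵢ≡xⱼ)

funToFin-cong : ∀ {m n} {f g : Fin m → Fin n} → f ≗ g → funToFin f ≡ funToFin g
funToFin-cong {zero}  _   = refl
funToFin-cong {suc m} f≗g = cong₂ combine (f≗g zero) (funToFin-cong (f≗g ∘ suc))

finToFun-injective : ∀ {m n} {s t : Fin (m ^ n)} → finToFun {m} {n} s ≗ finToFun t → s ≡ t
finToFun-injective {m} {n} {s} {t} s≗t = begin
  s                              ≡⟨ Finₚ.funToFin-finToFin {n} {m} s ⟨
  funToFin {n} {m} (finToFun s)  ≡⟨ funToFin-cong {n} {m} s≗t ⟩
  funToFin {n} {m} (finToFun t)  ≡⟨ Finₚ.funToFin-finToFin {n} {m} t ⟩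
  t                              ∎

_≟ᵖ_ : ∀ {n} → DecidableEquality (Pair n)
_≟ᵖ_ = Product.≡-dec _≟ˢ_ _≟ˢ_

isOne : Fin 2 → Bool
isOne b = does (b Finₚ.≟ suc zero)

isOne-injective : ∀ b c → isOne b ≡ isOne c → b ≡ c
isOne-injective zero       zero       _  = refl
isOne-injective (suc zero) (suc zero) _  = refl
isOne-injective zero       (suc zero) ()
isOne-injective (suc zero) zero       ()

selectedBy : ∀ {n} (ps : List (Pair n)) → (Fin (length ps) → Fin 2) → Subset n → Subset n → Bool
selectedBy ps β x y = does (Finₚ.any? λ k → (lookup ps k ≟ᵖ (x , y)) ×-dec (β k Finₚ.≟ suc zero))

selectedBy-lookup : ∀ {n} {ps : List (Pair n)} → Unique ps → ∀ β k →
  selectedBy ps β (proj₁ (lookup ps k)) (proj₂ (lookup ps k)) ≡ isOne (β k)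
selectedBy-lookup {ps = ps} unique β k =
  does-⇔ (mk⇔ chosen (λ βk≡1 → k , refl , βk≡1)) (Finₚ.any? _) (β k Finₚ.≟ suc zero)
  where
  chosen : (Σ _ λ k′ → lookup ps k′ ≡ lookup ps k × β k′ ≡ suc zero) → β k ≡ suc zero
  chosen (k′ , same , βk′≡1) =
    subst (λ k → β k ≡ suc zero) (Unique⇒lookup-injective unique same) βk′≡1

DistinctTransferSystems : ℕ → ℕ → Set
DistinctTransferSystems n m = Σ (Fin (2 ^ m) → Rel₂ n) λ f →
  (∀ t → IsTransferSystem (f t)) × (∀ s t → (∀ x y → f s x y ≡ f t x y) → s ≡ t)

-- Bit k of t, read through finToFun, decides whether the k-th pair of ps is an arrow.
distinctTransferSystems : ∀ {n N} (ps : List (Pair n)) → Unique ps → All (Critical N) ps →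
  DistinctTransferSystems n (length ps)
distinctTransferSystems {n} {N} ps unique critical = system , isTransferSystem , injective
  where
  system : Fin (2 ^ length ps) → Rel₂ n
  system t = Layer._◁ᵇ_ N (selectedBy ps (finToFun t))
  isTransferSystem : ∀ t → IsTransferSystem (system t)
  isTransferSystem t = Layer.isTransferSystem N (selectedBy ps (finToFun t))
  reads : ∀ t k → system t (proj₁ (lookup ps k)) (proj₂ (lookup ps k)) ≡ isOne (finToFun t k)
  reads t k with x⊆y , ∣x∣<∣y∣ , onLevel ← All.lookup critical (∈-lookup k) = trans
    (Layer.◁ᵇ-onLevel N (selectedBy ps (finToFun t)) x⊆y ∣x∣<∣y∣ onLevel)
    (selectedBy-lookup unique (finToFun t) k)
  injective : ∀ s t → (∀ x y → system s x y ≡ system t x y) → s ≡ t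
  injective s t same = finToFun-injective {2} {length ps} λ k →
    isOne-injective (finToFun s k) (finToFun t k)
      (trans (sym (reads s k)) (trans (same _ _) (reads t k)))

levelTransferSystems : ∀ n N lo hi → 2 * hi < N →
  DistinctTransferSystems n (sumRange lo hi (λ j → multinomial n j (N ∸ 2 * j)))
levelTransferSystems n N lo hi 2hi<N =
  subst (DistinctTransferSystems n) (length-criticalPairs n N lo hi)
    (distinctTransferSystems (criticalPairs n N lo hi)
      (criticalPairs-unique n N lo hi) (criticalPairs-critical n N lo hi 2hi<N))

2*[n/2]≤n : ∀ n → 2 * (n / 2) ≤ n
2*[n/2]≤n n = subst (_≤ n) (*-comm (n / 2) 2) (m/n*n≤m n 2)

mainTheorem8 : (n : ℕ) → 1 ≤ n →
    Σ (Fin (2 ^ a n) → Rel₂ n) λ f →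
      (∀ t → IsTransferSystem (f t)) ×
      (∀ s t → (∀ x y → f s x y ≡ f t x y) → s ≡ t)
mainTheorem8 n 1≤n with n % 2
... | zero  = levelTransferSystems n (n + 1) 1 (n / 2) (≤-<-trans (2*[n/2]≤n n) (m<m+n n z<s))
... | suc _ = levelTransferSystems n n 0 ((n ∸ 1) / 2) (2*[[n∸1]/2]<n 1≤n)
  where
  2*[[n∸1]/2]<n : ∀ {n} → 1 ≤ n → 2 * ((n ∸ 1) / 2) < n
  2*[[n∸1]/2]<n {suc n} _ = s≤s (2*[n/2]≤n n)
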